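{- Let $p$ be a prime and let $g(x)\in\mathbb{Z}[x]$ be a monic polynomial which is irreducible modulo $p$. Then, as ideals of $\mathbb{Z}[x]$, $$\langle p,g(x)\rangle^2=\langle p^2,g(x)\rangle\cap\langle p,g(x)^2\rangle.$$
   Context: For $S\subset\mathbb{Z}[x]$, $\langle S\rangle$ denotes the ideal of $\mathbb{Z}[x]$ generated by $S$. -}

module Defs where

open import Data.Nat using (ℕ; zero; suc; _<_)
open import Data.Integer using (ℤ; +_; _+_; _*_; _-_)
open import Data.Integer.Divisibility using (_∣_)
open import Data.List using (List; []; _∷_; map; zipWith; foldr)
open import Data.List.Relation.Unary.All using (All)
open import Data.Product using (Σ; ∃; _×_; _,_)
open import Data.Sum using (_⊎_)
open import Relation.Binary.PropositionalEquality using (_≡_)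
open import Relation.Nullary using (¬_)

-- Polynomials in ℤ[x] as coefficient lists, lowest degree first.
-- Trailing zeros are allowed; equality is coefficientwise (_≈P_).
Poly : Set
Poly = List ℤ

coeff : Poly → ℕ → ℤ
coeff []      _       = + 0
coeff (a ∷ f) zero    = a
coeff (a ∷ f) (suc n) = coeff f n

_≈P_ : Poly → Poly → Set
f ≈P g = ∀ n → coeff f n ≡ coeff g n

infixl 6 _+P_
infixl 7 _*P_

_+P_ : Poly → Poly → Poly
[]      +P g       = g
(a ∷ f) +P []      = a ∷ f
(a ∷ f) +P (b ∷ g) = (a + b) ∷ (f +P g)

scaleP : ℤ → Poly → Poly
scaleP a f = map (a *_) f

_*P_ : Poly → Poly → Poly
[]      *P g = []
(a ∷ f) *P g = scaleP a g +P (+ 0 ∷ (f *P g))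

constP : ℤ → Poly
constP a = a ∷ []

oneP : Poly
oneP = constP (+ 1)

sumP : List Poly → Poly
sumP = foldr _+P_ []

Ideal : Set₁
Ideal = Poly → Set

⟨_⟩ : List Poly → Ideal
⟨ S ⟩ f = Σ (List Poly) λ cs → f ≈P sumP (zipWith _*P_ cs S)

_·I_ : Ideal → Ideal → Ideal
(I ·I J) f = Σ (List (Poly × Poly)) λ ps →
  All (λ { (a , b) → I a × J b }) ps ×
  f ≈P sumP (map (λ { (a , b) → a *P b }) ps)

_∩I_ : Ideal → Ideal → Ideal
(I ∩I J) f = I f × J f

_≐_ : Ideal → Ideal → Set
I ≐ J = (∀ f → I f → J f) × (∀ f → J f → I f)

Monic : Poly → Set
Monic g = Σ ℕ λ d → (coeff g d ≡ + 1) × (∀ m → d < m → coeff g m ≡ + 0)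

-- Congruence of polynomials modulo an integer p (coefficientwise),
-- i.e. equality of the images in (ℤ/p)[x].
_≡P_[mod_] : Poly → Poly → ℤ → Set
f ≡P g [mod p ] = ∀ n → p ∣ (coeff f n - coeff g n)

-- Unit in (ℤ/p)[x], stated for a lift in ℤ[x].
UnitMod : ℤ → Poly → Set
UnitMod p a = Σ Poly λ u → (a *P u) ≡P oneP [mod p ]

IrreducibleMod : ℤ → Poly → Set
IrreducibleMod p g =
  ¬ (g ≡P [] [mod p ]) ×
  ¬ UnitMod p g ×
  (∀ a b → g ≡P (a *P b) [mod p ] → UnitMod p a ⊎ UnitMod p b)

module Submission where

-- If f = a q² + b g = c q + d g², then g (b − d g) = q (c − a q). As g is monic, q dividing
-- every coefficient of g h forces q to divide every coefficient of h (compare the top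
-- coefficient of h not divisible by q with the coefficient of g h lying deg g above it).
-- Hence b − d g = q e, and f = (a q) q + (b − d g) g + (d g) g lies in ⟨q, g⟩².

open import Algebra.Bundles using (AbelianGroup; CommutativeRing)
open import Algebra.Structures using (IsAbelianGroup)
open import Data.Integer using (ℤ; +_; _+_; _*_; _-_; -1ℤ)
open import Data.Integer.Divisibility.Signed using (_∣_; divides; ∣m∣n⇒∣m+n; ∣m∣n⇒∣m-n; ∣n⇒∣m*n)
import Data.Integer.Properties as ℤ
import Data.Integer.Tactic.RingSolver as ℤ-Solver
open import Data.List using ([]; _∷_; length; map)
open import Data.List.Relation.Unary.All using (All; []; _∷_)
open import Data.Maybe as Maybe using (Maybe; just; nothing)
open import Data.Nat as ℕ using (ℕ; zero; suc; _<_; _≤_; s≤s; z≤n)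
import Data.Nat.Properties as ℕ
open import Data.Nat.Primality using (Prime)
open import Data.Product using (∃; _,_; proj₁; proj₂)
open import Function using (_∘_)
open import Relation.Binary.Bundles using (Setoid)
open import Relation.Binary.PropositionalEquality
open import Relation.Binary.Structures using (IsEquivalence)
import Relation.Binary.Reasoning.Setoid as SetoidReasoning
open import Tactic.RingSolver using (solve-∀)
open import Tactic.RingSolver.Core.AlmostCommutativeRing using (AlmostCommutativeRing; fromCommutativeRing)
open import Defs

-- Wrapping _≈P_ in a record makes it injective in both sides, so they can be inferred.
infix 4 _≋_
record _≋_ (f g : Poly) : Set where
  constructor mk≋
  field coeff-≡ : f ≈P g
open _≋_

≋-isEquivalence : IsEquivalence _≋_
≋-isEquivalence = record
  { refl  = mk≋ λ _ → refl
  ; sym   = λ (mk≋ e) → mk≋ λ n → sym (e n)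
  ; trans = λ (mk≋ e) (mk≋ e′) → mk≋ λ n → trans (e n) (e′ n)
  }

≋-setoid : Setoid _ _
≋-setoid = record { isEquivalence = ≋-isEquivalence }

module ≋ = IsEquivalence ≋-isEquivalence
module ≋-Reasoning = SetoidReasoning ≋-setoid

≡⇒≋ : ∀ {f g} → f ≡ g → f ≋ g
≡⇒≋ refl = ≋.refl

∷-cong : ∀ {a b f g} → a ≡ b → f ≋ g → (a ∷ f) ≋ (b ∷ g)
∷-cong a≡b (mk≋ e) = mk≋ λ { zero → a≡b ; (suc n) → e n }

0∷[]≋[] : (+ 0 ∷ []) ≋ []
0∷[]≋[] = mk≋ λ { zero → refl ; (suc n) → refl }

coeff-+P : ∀ f g n → coeff (f +P g) n ≡ coeff f n + coeff g n
coeff-+P []      g       n       = sym (ℤ.+-identityˡ _)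
coeff-+P (a ∷ f) []      n       = sym (ℤ.+-identityʳ _)
coeff-+P (a ∷ f) (b ∷ g) zero    = refl
coeff-+P (a ∷ f) (b ∷ g) (suc n) = coeff-+P f g n

coeff-scaleP : ∀ a f n → coeff (scaleP a f) n ≡ a * coeff f n
coeff-scaleP a []      n       = sym (ℤ.*-zeroʳ a)
coeff-scaleP a (b ∷ f) zero    = refl
coeff-scaleP a (b ∷ f) (suc n) = coeff-scaleP a f n

negP : Poly → Poly
negP = scaleP -1ℤ

+P-cong : ∀ {f f′ g g′} → f ≋ f′ → g ≋ g′ → f +P g ≋ f′ +P g′
+P-cong {f} {f′} {g} {g′} (mk≋ e) (mk≋ e′) = mk≋ λ n → begin
  coeff (f +P g) n         ≡⟨ coeff-+P f g n ⟩
  coeff f n + coeff g n    ≡⟨ cong₂ _+_ (e n) (e′ n) ⟩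
  coeff f′ n + coeff g′ n  ≡⟨ coeff-+P f′ g′ n ⟨
  coeff (f′ +P g′) n       ∎
  where open ≡-Reasoning

+P-assoc : ∀ f g h → (f +P g) +P h ≋ f +P (g +P h)
+P-assoc []      g       h       = ≋.refl
+P-assoc (a ∷ f) []      h       = ≋.refl
+P-assoc (a ∷ f) (b ∷ g) []      = ≋.refl
+P-assoc (a ∷ f) (b ∷ g) (c ∷ h) = ∷-cong (ℤ.+-assoc a b c) (+P-assoc f g h)

+P-comm : ∀ f g → f +P g ≋ g +P f
+P-comm []      []      = ≋.refl
+P-comm []      (b ∷ g) = ≋.refl
+P-comm (a ∷ f) []      = ≋.refl
+P-comm (a ∷ f) (b ∷ g) = ∷-cong (ℤ.+-comm a b) (+P-comm f g)

+P-identityʳ : ∀ f → f +P [] ≡ f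
+P-identityʳ []      = refl
+P-identityʳ (a ∷ f) = refl

scaleP-cong : ∀ a {f g} → f ≋ g → scaleP a f ≋ scaleP a g
scaleP-cong a {f} {g} (mk≋ e) = mk≋ λ n →
  trans (coeff-scaleP a f n) (trans (cong (a *_) (e n)) (sym (coeff-scaleP a g n)))

negP-inverseʳ : ∀ f → f +P negP f ≋ []
negP-inverseʳ []      = ≋.refl
negP-inverseʳ (a ∷ f) = ≋.trans (∷-cong a-a≡0 (negP-inverseʳ f)) 0∷[]≋[]
  where
  a-a≡0 : a + -1ℤ * a ≡ + 0
  a-a≡0 = trans (cong (λ b → a + b) (ℤ.-1*i≡-i a)) (ℤ.+-inverseʳ a)

+P-isAbelianGroup : IsAbelianGroup _≋_ _+P_ [] negP
+P-isAbelianGroup = record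
  { isGroup = record
    { isMonoid = record
      { isSemigroup = record
        { isMagma = record { isEquivalence = ≋-isEquivalence ; ∙-cong = +P-cong }
        ; assoc   = +P-assoc
        }
      ; identity = (λ _ → ≋.refl) , (λ f → ≡⇒≋ (+P-identityʳ f))
      }
    ; inverse = (λ f → ≋.trans (+P-comm (negP f) f) (negP-inverseʳ f)) , negP-inverseʳ
    ; ⁻¹-cong = scaleP-cong -1ℤ
    }
  ; comm = +P-comm
  }

+P-abelianGroup : AbelianGroup _ _
+P-abelianGroup = record { isAbelianGroup = +P-isAbelianGroup }

open import Algebra.Properties.CommutativeSemigroup (AbelianGroup.commutativeSemigroup +P-abelianGroup)
  using (interchange; x∙yz≈y∙xz)

scaleP-+P : ∀ a f g → scaleP a (f +P g) ≡ scaleP a f +P scaleP a g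
scaleP-+P a []      g       = refl
scaleP-+P a (b ∷ f) []      = refl
scaleP-+P a (b ∷ f) (c ∷ g) = cong₂ _∷_ (ℤ.*-distribˡ-+ a b c) (scaleP-+P a f g)

scaleP-* : ∀ a b f → scaleP (a * b) f ≡ scaleP a (scaleP b f)
scaleP-* a b []      = refl
scaleP-* a b (c ∷ f) = cong₂ _∷_ (ℤ.*-assoc a b c) (scaleP-* a b f)

scaleP-identity : ∀ f → scaleP (+ 1) f ≡ f
scaleP-identity []      = refl
scaleP-identity (a ∷ f) = cong₂ _∷_ (ℤ.*-identityˡ a) (scaleP-identity f)

scaleP-zero : ∀ f → scaleP (+ 0) f ≋ []
scaleP-zero []      = ≋.refl
scaleP-zero (a ∷ f) = ≋.trans (∷-cong (ℤ.*-zeroˡ a) (scaleP-zero f)) 0∷[]≋[]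

*P-zeroʳ : ∀ f → f *P [] ≋ []
*P-zeroʳ []      = ≋.refl
*P-zeroʳ (a ∷ f) = ≋.trans (∷-cong refl (*P-zeroʳ f)) 0∷[]≋[]

*P-∷ʳ : ∀ f a g → f *P (a ∷ g) ≋ scaleP a f +P (+ 0 ∷ f *P g)
*P-∷ʳ []      a g = ≋.sym 0∷[]≋[]
*P-∷ʳ (b ∷ f) a g = ∷-cong (cong (_+ + 0) (ℤ.*-comm b a)) (begin
  scaleP b g +P f *P (a ∷ g)                     ≈⟨ +P-cong ≋.refl (*P-∷ʳ f a g) ⟩
  scaleP b g +P (scaleP a f +P (+ 0 ∷ f *P g))   ≈⟨ x∙yz≈y∙xz (scaleP b g) (scaleP a f) (+ 0 ∷ f *P g) ⟩
  scaleP a f +P (scaleP b g +P (+ 0 ∷ f *P g))   ∎)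
  where open ≋-Reasoning

*P-comm : ∀ f g → f *P g ≋ g *P f
*P-comm []      g = ≋.sym (*P-zeroʳ g)
*P-comm (a ∷ f) g = ≋.trans (+P-cong ≋.refl (∷-cong refl (*P-comm f g))) (≋.sym (*P-∷ʳ g a f))

*P-congʳ : ∀ f {g g′} → g ≋ g′ → f *P g ≋ f *P g′
*P-congʳ []      _ = ≋.refl
*P-congʳ (a ∷ f) e = +P-cong (scaleP-cong a e) (∷-cong refl (*P-congʳ f e))

*P-cong : ∀ {f f′ g g′} → f ≋ f′ → g ≋ g′ → f *P g ≋ f′ *P g′
*P-cong {f} {f′} {g} {g′} e e′ = begin
  f *P g    ≈⟨ *P-congʳ f e′ ⟩
  f *P g′   ≈⟨ *P-comm f g′ ⟩
  g′ *P f   ≈⟨ *P-congʳ g′ e ⟩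
  g′ *P f′  ≈⟨ *P-comm g′ f′ ⟩
  f′ *P g′  ∎
  where open ≋-Reasoning

*P-distribˡ : ∀ f g h → f *P (g +P h) ≋ f *P g +P f *P h
*P-distribˡ []      g h = ≋.refl
*P-distribˡ (a ∷ f) g h = begin
  scaleP a (g +P h) +P (+ 0 ∷ f *P (g +P h))
    ≈⟨ +P-cong (≡⇒≋ (scaleP-+P a g h)) (∷-cong refl (*P-distribˡ f g h)) ⟩
  (scaleP a g +P scaleP a h) +P ((+ 0 ∷ f *P g) +P (+ 0 ∷ f *P h))
    ≈⟨ interchange (scaleP a g) (scaleP a h) (+ 0 ∷ f *P g) (+ 0 ∷ f *P h) ⟩
  (scaleP a g +P (+ 0 ∷ f *P g)) +P (scaleP a h +P (+ 0 ∷ f *P h))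
    ∎
  where open ≋-Reasoning

*P-distribʳ : ∀ h f g → (f +P g) *P h ≋ f *P h +P g *P h
*P-distribʳ h f g = begin
  (f +P g) *P h       ≈⟨ *P-comm (f +P g) h ⟩
  h *P (f +P g)       ≈⟨ *P-distribˡ h f g ⟩
  h *P f +P h *P g    ≈⟨ +P-cong (*P-comm h f) (*P-comm h g) ⟩
  f *P h +P g *P h    ∎
  where open ≋-Reasoning

scaleP-*P : ∀ a f g → scaleP a f *P g ≋ scaleP a (f *P g)
scaleP-*P a []      g = ≋.refl
scaleP-*P a (b ∷ f) g = begin
  scaleP (a * b) g +P (+ 0 ∷ scaleP a f *P g)
    ≈⟨ +P-cong (≡⇒≋ (scaleP-* a b g)) (∷-cong (sym (ℤ.*-zeroʳ a)) (scaleP-*P a f g)) ⟩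
  scaleP a (scaleP b g) +P scaleP a (+ 0 ∷ f *P g)
    ≡⟨ scaleP-+P a (scaleP b g) (+ 0 ∷ f *P g) ⟨
  scaleP a (scaleP b g +P (+ 0 ∷ f *P g))
    ∎
  where open ≋-Reasoning

0∷-*P : ∀ f g → (+ 0 ∷ f) *P g ≋ (+ 0 ∷ f *P g)
0∷-*P f g = +P-cong (scaleP-zero g) ≋.refl

*P-assoc : ∀ f g h → (f *P g) *P h ≋ f *P (g *P h)
*P-assoc []      g h = ≋.refl
*P-assoc (a ∷ f) g h = begin
  (scaleP a g +P (+ 0 ∷ f *P g)) *P h
    ≈⟨ *P-distribʳ h (scaleP a g) (+ 0 ∷ f *P g) ⟩
  scaleP a g *P h +P (+ 0 ∷ f *P g) *P h
    ≈⟨ +P-cong (scaleP-*P a g h) (≋.trans (0∷-*P (f *P g) h) (∷-cong refl (*P-assoc f g h))) ⟩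
  scaleP a (g *P h) +P (+ 0 ∷ f *P (g *P h))
    ∎
  where open ≋-Reasoning

*P-identityˡ : ∀ f → oneP *P f ≋ f
*P-identityˡ f = ≋.trans (+P-cong (≡⇒≋ (scaleP-identity f)) 0∷[]≋[]) (≡⇒≋ (+P-identityʳ f))

ℤ[x] : CommutativeRing _ _
ℤ[x] = record
  { Carrier = Poly ; _≈_ = _≋_ ; _+_ = _+P_ ; _*_ = _*P_ ; -_ = negP ; 0# = [] ; 1# = oneP
  ; isCommutativeRing = record
    { isRing = record
      { +-isAbelianGroup = +P-isAbelianGroup
      ; *-cong           = *P-cong
      ; *-assoc          = *P-assoc
      ; *-identity       = *P-identityˡ , λ f → ≋.trans (*P-comm f oneP) (*P-identityˡ f)
      ; distrib          = *P-distribˡ , *P-distribʳ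
      }
    ; *-comm = *P-comm
    }
  }

[]≋? : ∀ f → Maybe ([] ≋ f)
[]≋? []           = just ≋.refl
[]≋? (+ zero ∷ f) = Maybe.map (λ []≋f → ≋.trans (≋.sym 0∷[]≋[]) (∷-cong refl []≋f)) ([]≋? f)
[]≋? (_ ∷ _)      = nothing

-- The solver keeps its coefficients in ℤ[x] itself and cancels them only when this zero test succeeds.
ℤ[x]-solver-ring : AlmostCommutativeRing _ _
ℤ[x]-solver-ring = fromCommutativeRing ℤ[x] []≋?

infix 4 _∣P_
_∣P_ : ℤ → Poly → Set
q ∣P f = ∀ n → q ∣ coeff f n

∣0 : ∀ q → q ∣ + 0
∣0 q = divides (+ 0) refl

coeff-≥length : ∀ f {n} → length f ≤ n → coeff f n ≡ + 0
coeff-≥length []               _         = refl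
coeff-≥length (a ∷ f) {suc n} (s≤s len≤n) = coeff-≥length f len≤n

coeff-∷-*P : ∀ a f g n → coeff ((a ∷ f) *P g) n ≡ a * coeff g n + coeff (+ 0 ∷ f *P g) n
coeff-∷-*P a f g n = trans (coeff-+P (scaleP a g) (+ 0 ∷ f *P g) n) (cong (_+ _) (coeff-scaleP a g n))

leading-coeff-*P-mod : ∀ {q} g h d m → (∀ i → d < i → coeff g i ≡ + 0) → (∀ j → m < j → q ∣ coeff h j) →
                       q ∣ coeff (g *P h) (d ℕ.+ m) - coeff g d * coeff h m
leading-coeff-*P-mod {q} [] h d m _ _ = ∣0 q
leading-coeff-*P-mod {q} (a ∷ g) h zero m g-vanishes _ =
  subst (q ∣_) (sym (trans (cong (_- a * coeff h m) coeff≡) (ℤ.+-inverseʳ (a * coeff h m)))) (∣0 q)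
  where
  g≋[] : g ≋ []
  g≋[] = mk≋ λ i → g-vanishes (suc i) (s≤s z≤n)
  0∷g*h≋[] : (+ 0 ∷ g *P h) ≋ []
  0∷g*h≋[] = ≋.trans (∷-cong refl (*P-cong g≋[] ≋.refl)) 0∷[]≋[]
  coeff≡ : coeff ((a ∷ g) *P h) m ≡ a * coeff h m
  coeff≡ = begin
    coeff ((a ∷ g) *P h) m                 ≡⟨ coeff-∷-*P a g h m ⟩
    a * coeff h m + coeff (+ 0 ∷ g *P h) m ≡⟨ cong (λ c → a * coeff h m + c) (coeff-≡ 0∷g*h≋[] m) ⟩
    a * coeff h m + + 0                    ≡⟨ ℤ.+-identityʳ _ ⟩
    a * coeff h m                          ∎
    where open ≡-Reasoning
leading-coeff-*P-mod {q} (a ∷ g) h (suc d) m g-vanishes h-divisible =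
  subst (q ∣_) (sym coeff≡) (∣m∣n⇒∣m+n (∣n⇒∣m*n a (h-divisible _ (s≤s (ℕ.m≤n+m m d)))) rest)
  where
  rest : q ∣ coeff (g *P h) (d ℕ.+ m) - coeff g d * coeff h m
  rest = leading-coeff-*P-mod g h d m (λ i d<i → g-vanishes (suc i) (s≤s d<i)) h-divisible
  coeff≡ : coeff ((a ∷ g) *P h) (suc d ℕ.+ m) - coeff g d * coeff h m
         ≡ a * coeff h (suc (d ℕ.+ m)) + (coeff (g *P h) (d ℕ.+ m) - coeff g d * coeff h m)
  coeff≡ = trans (cong (_- coeff g d * coeff h m) (coeff-∷-*P a g h (suc d ℕ.+ m)))
                 (ℤ.+-assoc (a * coeff h (suc (d ℕ.+ m))) _ _)

monic-∣P-cancelˡ : ∀ {q g h} → Monic g → q ∣P g *P h → q ∣P h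
monic-∣P-cancelˡ {q} {g} {h} (d , g-d≡1 , g-vanishes) q∣gh m = downward (length h) m (ℕ.m≤m+n (length h) m)
  where
  x-[x-1*y]≡y : ∀ x y → x - (x - + 1 * y) ≡ y
  x-[x-1*y]≡y = ℤ-Solver.solve-∀
  downward : ∀ k m → length h ≤ k ℕ.+ m → q ∣ coeff h m
  downward zero    m len≤m = subst (q ∣_) (sym (coeff-≥length h len≤m)) (∣0 q)
  downward (suc k) m len≤  = subst (q ∣_) (x-[x-1*y]≡y (coeff (g *P h) (d ℕ.+ m)) (coeff h m)) (∣m∣n⇒∣m-n (q∣gh (d ℕ.+ m)) top)
    where
    above : ∀ j → m < j → q ∣ coeff h j
    above j m<j = downward k j (ℕ.≤-trans len≤ (ℕ.≤-trans (ℕ.≤-reflexive (sym (ℕ.+-suc k m))) (ℕ.+-monoʳ-≤ k m<j)))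
    top : q ∣ coeff (g *P h) (d ℕ.+ m) - + 1 * coeff h m
    top = subst (λ c → q ∣ coeff (g *P h) (d ℕ.+ m) - c * coeff h m) g-d≡1
                (leading-coeff-*P-mod g h d m g-vanishes above)

∣P⇒scaleP : ∀ {q h} → q ∣P h → ∃ λ e → h ≋ scaleP q e
∣P⇒scaleP {q} {[]}    _   = [] , ≋.refl
∣P⇒scaleP {q} {a ∷ h} q∣h with q∣h zero | ∣P⇒scaleP {q} {h} (q∣h ∘ suc)
... | divides k a≡kq | e , h≋qe = k ∷ e , ∷-cong (trans a≡kq (ℤ.*-comm k q)) h≋qe

∣P-resp-≋ : ∀ {q f g} → f ≋ g → q ∣P f → q ∣P g
∣P-resp-≋ {q} (mk≋ f≈g) q∣f n = subst (q ∣_) (f≈g n) (q∣f n)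

constP-*P : ∀ a f → constP a *P f ≋ scaleP a f
constP-*P a f = ≋.trans (+P-cong ≋.refl 0∷[]≋[]) (≡⇒≋ (+P-identityʳ (scaleP a f)))

∣P-constP-*P : ∀ q f → q ∣P constP q *P f
∣P-constP-*P q f = ∣P-resp-≋ (≋.sym (constP-*P q f))
  λ n → divides (coeff f n) (trans (coeff-scaleP q f n) (ℤ.*-comm q (coeff f n)))

constP-*P-constP : ∀ a b → constP a *P constP b ≋ constP (a * b)
constP-*P-constP a b = ∷-cong (ℤ.+-identityʳ (a * b)) ≋.refl

record Span₂ (A B f : Poly) : Set where
  constructor span₂
  field
    coeffˡ coeffʳ : Poly
    combination   : f ≋ coeffˡ *P A +P coeffʳ *P B

⟨⟩⇒Span₂ : ∀ {A B f} → ⟨ A ∷ B ∷ [] ⟩ f → Span₂ A B f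
⟨⟩⇒Span₂         ([]            , f≈) = span₂ [] [] (mk≋ f≈)
⟨⟩⇒Span₂         (c ∷ []        , f≈) = span₂ c [] (mk≋ f≈)
⟨⟩⇒Span₂ {A} {B} (c ∷ d ∷ []    , f≈) = span₂ c d (≋.trans (mk≋ f≈) (≡⇒≋ (cong (c *P A +P_) (+P-identityʳ (d *P B)))))
⟨⟩⇒Span₂ {A} {B} (c ∷ d ∷ _ ∷ _ , f≈) = span₂ c d (≋.trans (mk≋ f≈) (≡⇒≋ (cong (c *P A +P_) (+P-identityʳ (d *P B)))))

Span₂⇒⟨⟩ : ∀ {A B f} → Span₂ A B f → ⟨ A ∷ B ∷ [] ⟩ f
Span₂⇒⟨⟩ {A} {B} (span₂ c d f≋) = c ∷ d ∷ [] , coeff-≡ (≋.trans f≋ (≡⇒≋ (cong (c *P A +P_) (sym (+P-identityʳ (d *P B))))))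

Span₂-resp-≋ : ∀ {A B f g} → f ≋ g → Span₂ A B f → Span₂ A B g
Span₂-resp-≋ f≋g (span₂ c d f≋) = span₂ c d (≋.trans (≋.sym f≋g) f≋)

Span₂-congˡ : ∀ {A A′ B f} → A ≋ A′ → Span₂ A B f → Span₂ A′ B f
Span₂-congˡ A≋A′ (span₂ c d f≋) = span₂ c d (≋.trans f≋ (+P-cong (*P-congʳ c A≋A′) ≋.refl))

Span₂-comm : ∀ {A B f} → Span₂ A B f → Span₂ B A f
Span₂-comm {A} {B} (span₂ c d f≋) = span₂ d c (≋.trans f≋ (+P-comm (c *P A) (d *P B)))

Span₂-multipleˡ : ∀ {A B} r → Span₂ A B (r *P A)
Span₂-multipleˡ {A} r = span₂ r [] (≡⇒≋ (sym (+P-identityʳ (r *P A))))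

Span₂-multipleʳ : ∀ {A B} r → Span₂ A B (r *P B)
Span₂-multipleʳ r = span₂ [] r ≋.refl

∣P⇒Span₂ : ∀ {q B h} → q ∣P h → Span₂ (constP q) B h
∣P⇒Span₂ {q} {B} {h} q∣h with ∣P⇒scaleP q∣h
... | e , h≋qe = Span₂-resp-≋ e*Q≋h (Span₂-multipleˡ e)
  where
  e*Q≋h : e *P constP q ≋ h
  e*Q≋h = ≋.trans (*P-comm e (constP q)) (≋.trans (constP-*P q e) (≋.sym h≋qe))

Span₂-+P : ∀ {A B f g} → Span₂ A B f → Span₂ A B g → Span₂ A B (f +P g)
Span₂-+P {A} {B} (span₂ c d f≋) (span₂ c′ d′ g≋) = span₂ (c +P c′) (d +P d′) (≋.trans (+P-cong f≋ g≋) (regroup c d c′ d′ A B))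
  where
  regroup : ∀ c d c′ d′ A B → (c *P A +P d *P B) +P (c′ *P A +P d′ *P B) ≋ (c +P c′) *P A +P (d +P d′) *P B
  regroup = solve-∀ ℤ[x]-solver-ring

Span₂-*P-squareˡ : ∀ {A B f g} → Span₂ A B f → Span₂ A B g → Span₂ (A *P A) B (f *P g)
Span₂-*P-squareˡ {A} {B} (span₂ c d f≋) (span₂ c′ d′ g≋) =
  span₂ (c *P c′) (c *P A *P d′ +P d *P (c′ *P A +P d′ *P B)) (≋.trans (*P-cong f≋ g≋) (expand c d c′ d′ A B))
  where
  expand : ∀ c d c′ d′ A B → (c *P A +P d *P B) *P (c′ *P A +P d′ *P B)
                          ≋ (c *P c′) *P (A *P A) +P (c *P A *P d′ +P d *P (c′ *P A +P d′ *P B)) *P B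
  expand = solve-∀ ℤ[x]-solver-ring

Span₂-*P-squareʳ : ∀ {A B f g} → Span₂ A B f → Span₂ A B g → Span₂ A (B *P B) (f *P g)
Span₂-*P-squareʳ f∈ g∈ = Span₂-comm (Span₂-*P-squareˡ (Span₂-comm f∈) (Span₂-comm g∈))

sumP-∈-Span₂ : ∀ {A B} {X : Set} {P : X → Set} (F : X → Poly) → (∀ x → P x → Span₂ A B (F x)) →
               ∀ {xs} → All P xs → Span₂ A B (sumP (map F xs))
sumP-∈-Span₂ F F∈ []         = span₂ [] [] ≋.refl
sumP-∈-Span₂ F F∈ (px ∷ pxs) = Span₂-+P (F∈ _ px) (sumP-∈-Span₂ F F∈ pxs)

⟨A,B⟩²⊆Span₂ : ∀ {A B C D} → (∀ {a b} → Span₂ A B a → Span₂ A B b → Span₂ C D (a *P b)) →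
               ∀ f → (⟨ A ∷ B ∷ [] ⟩ ·I ⟨ A ∷ B ∷ [] ⟩) f → Span₂ C D f
⟨A,B⟩²⊆Span₂ product f (ps , ps∈ , f≈) =
  Span₂-resp-≋ (≋.sym (mk≋ f≈))
    (sumP-∈-Span₂ _ (λ { (a , b) (a∈ , b∈) → product (⟨⟩⇒Span₂ {f = a} a∈) (⟨⟩⇒Span₂ {f = b} b∈) }) ps∈)

·I⊆∩ : ∀ {A B} f → (⟨ A ∷ B ∷ [] ⟩ ·I ⟨ A ∷ B ∷ [] ⟩) f → (Span₂ (A *P A) B ∩I Span₂ A (B *P B)) f
·I⊆∩ {A} {B} f f∈ = ⟨A,B⟩²⊆Span₂ {A} {B} Span₂-*P-squareˡ f f∈ , ⟨A,B⟩²⊆Span₂ {A} {B} Span₂-*P-squareʳ f f∈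

cofactor-∣P : ∀ q g a b c d {f} → Monic g →
              f ≋ a *P (constP q *P constP q) +P b *P g → f ≋ c *P constP q +P d *P (g *P g) →
              q ∣P b +P negP (d *P g)
cofactor-∣P q g a b c d monic f≋₁ f≋₂ =
  monic-∣P-cancelˡ {g = g} monic (∣P-resp-≋ (≋.sym g*cofactor≋) (∣P-constP-*P q (c +P negP (a *P Q))))
  where
  Q = constP q
  eliminate-f : ∀ a b d g X → g *P (b +P negP (d *P g)) ≋ ((a *P X +P b *P g) +P negP (a *P X)) +P negP (d *P (g *P g))
  eliminate-f = solve-∀ ℤ[x]-solver-ring
  collect-Q : ∀ a c d g Q → ((c *P Q +P d *P (g *P g)) +P negP (a *P (Q *P Q))) +P negP (d *P (g *P g)) ≋ Q *P (c +P negP (a *P Q))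
  collect-Q = solve-∀ ℤ[x]-solver-ring
  g*cofactor≋ : g *P (b +P negP (d *P g)) ≋ Q *P (c +P negP (a *P Q))
  g*cofactor≋ = begin
    g *P (b +P negP (d *P g))
      ≈⟨ eliminate-f a b d g (Q *P Q) ⟩
    ((a *P (Q *P Q) +P b *P g) +P negP (a *P (Q *P Q))) +P negP (d *P (g *P g))
      ≈⟨ +P-cong (+P-cong (≋.trans (≋.sym f≋₁) f≋₂) ≋.refl) ≋.refl ⟩
    ((c *P Q +P d *P (g *P g)) +P negP (a *P (Q *P Q))) +P negP (d *P (g *P g))
      ≈⟨ collect-Q a c d g Q ⟩
    Q *P (c +P negP (a *P Q))
      ∎
    where open ≋-Reasoning

∩⊆·I : ∀ {q g} → Monic g → ∀ f → (Span₂ (constP q *P constP q) g ∩I Span₂ (constP q) (g *P g)) f →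
       (⟨ constP q ∷ g ∷ [] ⟩ ·I ⟨ constP q ∷ g ∷ [] ⟩) f
∩⊆·I {q} {g} monic f ((span₂ a b f≋₁) , (span₂ c d f≋₂)) =
  (a *P Q , Q) ∷ (b +P negP (d *P g) , g) ∷ (d *P g , g) ∷ [] ,
  (Span₂⇒⟨⟩ (Span₂-multipleˡ a) , Span₂⇒⟨⟩ Q∈) ∷
  (Span₂⇒⟨⟩ cofactor∈ , Span₂⇒⟨⟩ g∈) ∷
  (Span₂⇒⟨⟩ (Span₂-multipleʳ d) , Span₂⇒⟨⟩ g∈) ∷ [] ,
  coeff-≡ f≋products
  where
  Q = constP q
  Q∈ : Span₂ Q g Q
  Q∈ = Span₂-resp-≋ (*P-identityˡ Q) (Span₂-multipleˡ oneP)
  g∈ : Span₂ Q g g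
  g∈ = Span₂-resp-≋ (*P-identityˡ g) (Span₂-multipleʳ oneP)
  cofactor∈ : Span₂ Q g (b +P negP (d *P g))
  cofactor∈ = ∣P⇒Span₂ (cofactor-∣P q g a b c d monic f≋₁ f≋₂)
  regroup : ∀ a b d g Q → a *P (Q *P Q) +P b *P g
                        ≋ (a *P Q) *P Q +P ((b +P negP (d *P g)) *P g +P ((d *P g) *P g +P []))
  regroup = solve-∀ ℤ[x]-solver-ring
  f≋products : f ≋ (a *P Q) *P Q +P ((b +P negP (d *P g)) *P g +P ((d *P g) *P g +P []))
  f≋products = ≋.trans f≋₁ (regroup a b d g Q)

⟨q,g⟩²≐⟨q²,g⟩∩⟨q,g²⟩ : ∀ q g → Monic g →
  (⟨ constP q ∷ g ∷ [] ⟩ ·I ⟨ constP q ∷ g ∷ [] ⟩) ≐ (⟨ constP (q * q) ∷ g ∷ [] ⟩ ∩I ⟨ constP q ∷ (g *P g) ∷ [] ⟩)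
⟨q,g⟩²≐⟨q²,g⟩∩⟨q,g²⟩ q g monic = ⊆ , ⊇
  where
  Q = constP q
  Q*Q≋ : Q *P Q ≋ constP (q * q)
  Q*Q≋ = constP-*P-constP q q
  ⊆ : ∀ f → (⟨ Q ∷ g ∷ [] ⟩ ·I ⟨ Q ∷ g ∷ [] ⟩) f → (⟨ constP (q * q) ∷ g ∷ [] ⟩ ∩I ⟨ Q ∷ (g *P g) ∷ [] ⟩) f
  ⊆ f f∈ = Span₂⇒⟨⟩ (Span₂-congˡ Q*Q≋ (proj₁ f∈∩)) , Span₂⇒⟨⟩ (proj₂ f∈∩)
    where
    f∈∩ : (Span₂ (Q *P Q) g ∩I Span₂ Q (g *P g)) f
    f∈∩ = ·I⊆∩ {Q} {g} f f∈
  ⊇ : ∀ f → (⟨ constP (q * q) ∷ g ∷ [] ⟩ ∩I ⟨ Q ∷ (g *P g) ∷ [] ⟩) f → (⟨ Q ∷ g ∷ [] ⟩ ·I ⟨ Q ∷ g ∷ [] ⟩) f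
  ⊇ f (f∈₁ , f∈₂) = ∩⊆·I monic f (Span₂-congˡ (≋.sym Q*Q≋) (⟨⟩⇒Span₂ f∈₁) , ⟨⟩⇒Span₂ f∈₂)

lemma2p1 : (p : ℕ) → Prime p → (g : Poly) → Monic g → IrreducibleMod (+ p) g →
    (⟨ constP (+ p) ∷ g ∷ [] ⟩ ·I ⟨ constP (+ p) ∷ g ∷ [] ⟩)
      ≐ (⟨ constP (+ p * + p) ∷ g ∷ [] ⟩ ∩I ⟨ constP (+ p) ∷ (g *P g) ∷ [] ⟩)
lemma2p1 p _ g monic _ = ⟨q,g⟩²≐⟨q²,g⟩∩⟨q,g²⟩ (+ p) g monic
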